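{- Let $A$ be a finite set. Let $R=\{(a,b,c)\in A^3\mid a=b\ \text{or}\ b=c\}$ and let $w:A^2\to(\mathbb{N}_0,+)$ be given by $w(a,a)=1$ and $w(a,b)=0$ for $a\neq b$. Then $\mathrm{Deg}(A)=\mathrm{Pol}(w_R)=\mathrm{Pol}(w)$.
   Context: $B_n(A)=\mathrm{Sym}(A^n)$, $B(A)=\bigcup_n B_n(A)$. For a weight map $w:A^k\to(M,\cdot)$ into a commutative monoid, $f\in B_n(A)$ respects $w$ if for every $k\times n$ array $a$ over $A$, the product of $w$ over the columns of $a$ equals the product of $w$ over the columns of $f(a)$, the array obtained by applying $f$ to each row of $a$; $\mathrm{Pol}(w)$ is the set of all $f\in B(A)$ respecting $w$. $w_R:A^3\to(\{0,1\},\wedge)$ is the characteristic function of $R$. $\mathrm{Deg}(A)=\bigcup_n\{\pi_\alpha\bullet(\beta_1\oplus\dots\oplus\beta_n)\mid\alpha\in S_n,\beta_i\in\mathrm{Sym}(A)\}$: the permutations of $A^n$ (all $n$) obtained by applying a permutation $\beta_i$ of $A$ to each coordinate $i$ and then permuting coordinates by $\pi_\alpha(x_1,\dots,x_n)=(x_{\alpha^{ -1}(1)},\dots,x_{\alpha^{ -1}(n)})$. -}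

module Defs where

open import Level using (Level)
open import Data.Nat using (ℕ)
open import Data.Bool using (Bool; _∨_)
open import Data.Fin using (Fin)
open import Data.Fin.Permutation using (Permutation′; _⟨$⟩ʳ_; _⟨$⟩ˡ_)
open import Data.Vec using (Vec; []; _∷_; lookup; tabulate; map; transpose; foldr′)
open import Data.Product using (Σ; ∃; ∃-syntax; _×_; _,_)
open import Data.Sum using (_⊎_)
open import Data.Bool.Properties using (∧-commutativeMonoid)
open import Data.Nat.Properties using (+-0-commutativeMonoid)
open import Algebra.Bundles using (CommutativeMonoid)
open import Function using (_↔_; Inverse)
open import Relation.Binary.PropositionalEquality using (_≡_)
open import Relation.Nullary using (does; Dec)
open import Relation.Nullary.Decidable using (_⊎-dec_)
open import Data.Fin using (_≟_)

-- The finite set A is taken to be Fin m.  A^n is Vec (Fin m) n.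

B : ℕ → ℕ → Set
B m n = Vec (Fin m) n ↔ Vec (Fin m) n

prod : ∀ {c ℓ} (M : CommutativeMonoid c ℓ) {k : ℕ} →
       Vec (CommutativeMonoid.Carrier M) k → CommutativeMonoid.Carrier M
prod M = foldr′ (CommutativeMonoid._∙_ M) (CommutativeMonoid.ε M)

Respects : ∀ {c ℓ} {m k n : ℕ} (M : CommutativeMonoid c ℓ) →
           (Vec (Fin m) k → CommutativeMonoid.Carrier M) → B m n → Set ℓ
Respects {m = m} {k} {n} M w f =
  ∀ (a : Vec (Vec (Fin m) n) k) →
    CommutativeMonoid._≈_ M
      (prod M (map w (transpose a)))
      (prod M (map w (transpose (map (Inverse.to f) a))))

-- f ∈ Pol(w)  (Pol(w) ⊆ B(A) = ⋃ₙ Bₙ(A); membership of f ∈ Bₙ(A))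
InPol : ∀ {c ℓ} {m k n : ℕ} (M : CommutativeMonoid c ℓ) →
        (Vec (Fin m) k → CommutativeMonoid.Carrier M) → B m n → Set ℓ
InPol = Respects

-- π_α • (β₁ ⊕ … ⊕ βₙ) applied to x:
-- the i-th coordinate is β_{α⁻¹(i)} (x_{α⁻¹(i)}).
degMap : ∀ {m n : ℕ} → Permutation′ n → Vec (Permutation′ m) n →
         Vec (Fin m) n → Vec (Fin m) n
degMap α β x = tabulate (λ i → lookup β (α ⟨$⟩ˡ i) ⟨$⟩ʳ lookup x (α ⟨$⟩ˡ i))

InDeg : ∀ {m n : ℕ} → B m n → Set
InDeg {m} {n} f =
  ∃[ α ] ∃[ β ] (∀ (x : Vec (Fin m) n) → Inverse.to f x ≡ degMap {m} {n} α β x)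

R : ∀ {m} → Vec (Fin m) 3 → Set
R (a ∷ b ∷ c ∷ []) = a ≡ b ⊎ b ≡ c

R? : ∀ {m} (v : Vec (Fin m) 3) → Dec (R v)
R? (a ∷ b ∷ c ∷ []) = (a ≟ b) ⊎-dec (b ≟ c)

wR : ∀ {m} → Vec (Fin m) 3 → Bool
wR v = does (R? v)

wEq : ∀ {m} → Vec (Fin m) 2 → ℕ
wEq (a ∷ b ∷ []) with a ≟ b
... | Relation.Nullary.yes _ = 1
... | Relation.Nullary.no _ = 0

∧-monoid : CommutativeMonoid _ _
∧-monoid = ∧-commutativeMonoid
+-monoid : CommutativeMonoid _ _
+-monoid = +-0-commutativeMonoid

{-# OPTIONS --safe #-}
module Submission where

-- Both weights detect exactly the coordinatewise betweenness relation
-- "y_t ∈ {x_t, z_t} for every t": for w_R this is immediate, and for w it is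
-- the equality case of [x_t = y_t] + [y_t = z_t] ≤ 1 + [x_t = z_t], summed over
-- the columns. So Pol(w_R) = Pol(w) consists of the bijections of A^n that
-- preserve and reflect betweenness. Such a bijection f maps each line
-- {y | y agrees with x off coordinate i} into a line, and lines through
-- neighbouring points go to parallel lines, so the direction α(i) of the image
-- line depends on i only; then f(x)_{α(i)} depends on x_i only, which writes f
-- as π_α • (β₁ ⊕ … ⊕ βₙ). Conversely, such an f permutes the columns of an
-- array and relabels each column by a permutation of A, which changes neither
-- w_R nor w.

open import Defs
open import Algebra.Bundles using (CommutativeMonoid)
import Algebra.Properties.CommutativeMonoid.Sum as MonoidSum
open import Data.Bool using (Bool; T)
open import Data.Bool.Properties using (T-∧)
open import Data.Empty using (⊥; ⊥-elim)
open import Data.Fin using (Fin; zero; suc; punchOut)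
open import Data.Fin.Permutation as Perm using (Permutation′; permutation; _⟨$⟩ʳ_; _⟨$⟩ˡ_)
open import Data.Fin.Properties
  using (_≟_; any?; ¬∀⟶∃¬; suc-injective; punchOut-injective; injective⇒≤)
open import Data.Nat using (ℕ; zero; suc; _+_; _≤_; z≤n)
open import Data.Nat.Properties
  using ( +-commutativeSemigroup; +-comm; +-mono-≤; +-monoʳ-≤; +-cancelʳ-≤; +-cancelˡ-≡
        ; ≤-antisym; ≤-trans; ≤-reflexive; 1+n≰n; module ≤-Reasoning)
open import Algebra.Properties.CommutativeSemigroup +-commutativeSemigroup using (interchange)
open import Data.Product using (∃; _×_; _,_; proj₁; proj₂)
open import Data.Sum using (_⊎_; inj₁; inj₂)
import Data.Sum as Sum
open import Data.Vec using (Vec; []; _∷_; lookup; tabulate; replicate; map; transpose; _⊛_; _[_]≔_)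
open import Data.Vec.Properties
  using ( lookup∘update; lookup∘update′; lookup-replicate; lookup-map; lookup-⊛; lookup∘tabulate
        ; map-∘; map-cong)
open import Data.Vec.Relation.Binary.Pointwise.Extensional using (ext; Pointwise-≡⇒≡)
open import Function using (_∘_; _$_; flip; Inverse; Injection; Equivalence; _⇔_; mk⇔)
open import Function.Definitions using (Injective)
open import Function.Properties.Inverse using (↔⇒↣)
open import Relation.Binary.Definitions using (DecidableEquality)
open import Relation.Binary.PropositionalEquality
  using (_≡_; _≢_; refl; sym; trans; cong; cong₂; subst; module ≡-Reasoning)
open import Relation.Nullary using (¬_; yes; no; Irrelevant; contradiction)
open import Relation.Nullary.Decidable using (does-⇔)

injective⇒surjective : ∀ {n} (h : Fin n → Fin n) → Injective _≡_ _≡_ h →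
                       ∀ j → ∃ λ i → h i ≡ j
injective⇒surjective {zero} h h-injective ()
injective⇒surjective {suc n} h h-injective j with any? (λ i → h i ≟ j)
... | yes hit = hit
... | no miss = contradiction (injective⇒≤ h′-injective) 1+n≰n
  where
  j≢h : ∀ i → j ≢ h i
  j≢h i j≡hi = miss (i , sym j≡hi)
  h′ : Fin (suc n) → Fin n
  h′ i = punchOut (j≢h i)
  h′-injective : Injective _≡_ _≡_ h′
  h′-injective = h-injective ∘ punchOut-injective (j≢h _) (j≢h _)

permutationOf : ∀ {n} (h : Fin n → Fin n) → Injective _≡_ _≡_ h → Permutation′ n
permutationOf h h-injective =
  permutation h (proj₁ ∘ surjective) (proj₂ ∘ surjective)
              (λ i → h-injective (proj₂ (surjective (h i))))
  where
  surjective : ∀ j → ∃ λ i → h i ≡ j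
  surjective = injective⇒surjective h h-injective

module Hamming {a} {A : Set a} (_≟ᴬ_ : DecidableEquality A) where

  private variable
    n : ℕ
    i j k : Fin n
    u v w x y z : Vec A n

  record AgreeOff (i : Fin n) (x y : Vec A n) : Set a where
    constructor agreeOff
    field agree : ∀ t → t ≢ i → lookup x t ≡ lookup y t

  record Neighbours (x y : Vec A n) : Set a where
    constructor neighbours
    field near : ∀ t → lookup x t ≢ lookup y t → AgreeOff t x y

  record Between (x y z : Vec A n) : Set a where
    constructor coordinatewise
    field between : ∀ t → lookup x t ≡ lookup y t ⊎ lookup y t ≡ lookup z t

  open AgreeOff public
  open Neighbours public
  open Between public

  agreeOff-sym : AgreeOff i x y → AgreeOff i y x
  agreeOff-sym x~y = agreeOff λ t t≢i → sym (agree x~y t t≢i)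

  agreeOff-trans : AgreeOff i x y → AgreeOff i y z → AgreeOff i x z
  agreeOff-trans x~y y~z = agreeOff λ t t≢i → trans (agree x~y t t≢i) (agree y~z t t≢i)

  agreeOff-update : ∀ (x : Vec A n) i b → AgreeOff i x (x [ i ]≔ b)
  agreeOff-update x i b = agreeOff λ t t≢i → sym (lookup∘update′ t≢i x b)

  agreeOff-head : ∀ b c (x : Vec A n) → AgreeOff zero (b ∷ x) (c ∷ x)
  agreeOff-head b c x = agreeOff λ where
    zero 0≢0 → contradiction refl 0≢0
    (suc t) _ → refl

  agreeOff-∷ : ∀ {b} → AgreeOff k x y → AgreeOff (suc k) (b ∷ x) (b ∷ y)
  agreeOff-∷ x~y = agreeOff λ where
    zero _ → refl
    (suc t) t≢k → agree x~y t (t≢k ∘ cong suc)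

  agreeOff⇒≡ : AgreeOff i x y → lookup x i ≡ lookup y i → x ≡ y
  agreeOff⇒≡ {i = i} {x = x} {y} x~y xᵢ≡yᵢ = Pointwise-≡⇒≡ (ext agreeAt)
    where
    agreeAt : ∀ t → lookup x t ≡ lookup y t
    agreeAt t with t ≟ i
    ... | yes refl = xᵢ≡yᵢ
    ... | no t≢i = agree x~y t t≢i

  ≢⇒lookup-≢ : x ≢ y → ∃ λ t → lookup x t ≢ lookup y t
  ≢⇒lookup-≢ {n} {x} {y} x≢y =
    ¬∀⟶∃¬ n _ (λ t → lookup x t ≟ᴬ lookup y t) (x≢y ∘ Pointwise-≡⇒≡ ∘ ext)

  agreeOff⇒between : AgreeOff k x y → lookup y k ≡ lookup z k → Between x y z
  agreeOff⇒between {k = k} {x = x} {y} {z} x~y yₖ≡zₖ = coordinatewise pick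
    where
    pick : ∀ t → lookup x t ≡ lookup y t ⊎ lookup y t ≡ lookup z t
    pick t with t ≟ k
    ... | yes refl = inj₂ yₖ≡zₖ
    ... | no t≢k = inj₁ (agree x~y t t≢k)

  between-update : ∀ (x z : Vec A n) i → Between x (x [ i ]≔ lookup z i) z
  between-update x z i =
    agreeOff⇒between (agreeOff-update x i (lookup z i)) (lookup∘update i x (lookup z i))

  between-agreeOff : AgreeOff i x z → Between x y z → AgreeOff i y x
  between-agreeOff x~z x-y-z = agreeOff λ t t≢i →
    Sum.[ sym , (λ yₜ≡zₜ → trans yₜ≡zₜ (sym (agree x~z t t≢i))) ] (between x-y-z t)

  line-endpoints : AgreeOff i x z → Between x y z → y ≡ x ⊎ y ≡ z
  line-endpoints {i = i} {x = x} {z} {y} x~z x-y-z =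
    Sum.map (agreeOff⇒≡ y~x ∘ sym) (agreeOff⇒≡ (agreeOff-trans y~x x~z)) (between x-y-z i)
    where
    y~x : AgreeOff i y x
    y~x = between-agreeOff x~z x-y-z

  endpoints⇒neighbours : (∀ {y} → Between x y z → y ≡ x ⊎ y ≡ z) → Neighbours x z
  endpoints⇒neighbours {x = x} {z} endpoints =
    neighbours λ t xₜ≢zₜ → agreeOff (agreeAt t xₜ≢zₜ)
    where
    agreeAt : ∀ t → lookup x t ≢ lookup z t → ∀ s → s ≢ t → lookup x s ≡ lookup z s
    agreeAt t xₜ≢zₜ s s≢t with lookup x s ≟ᴬ lookup z s
    ... | yes xₛ≡zₛ = xₛ≡zₛ
    ... | no xₛ≢zₛ with endpoints (between-update x z t)
    ...   | inj₁ y≡x =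
      contradiction (trans (cong (flip lookup t) (sym y≡x)) (lookup∘update t x _)) xₜ≢zₜ
    ...   | inj₂ y≡z =
      contradiction (trans (sym (lookup∘update′ s≢t x _)) (cong (flip lookup s) y≡z)) xₛ≢zₛ

  triangle-in-line : AgreeOff j x y → x ≢ y → Neighbours x z → Neighbours y z → AgreeOff j x z
  triangle-in-line {j = j} {x = x} {y} {z} x~y x≢y x≈z y≈z = agreeOff agreeAt
    where
    agreeAt : ∀ t → t ≢ j → lookup x t ≡ lookup z t
    agreeAt t t≢j with lookup x t ≟ᴬ lookup z t
    ... | yes xₜ≡zₜ = xₜ≡zₜ
    ... | no xₜ≢zₜ = contradiction (trans (agree x~y t t≢j) (agree y~z t t≢j)) xₜ≢zₜ
      where
      x~z : AgreeOff t x z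
      x~z = near x≈z t xₜ≢zₜ
      yⱼ≢zⱼ : lookup y j ≢ lookup z j
      yⱼ≢zⱼ yⱼ≡zⱼ = x≢y (agreeOff⇒≡ x~y (trans (agree x~z j (t≢j ∘ sym)) (sym yⱼ≡zⱼ)))
      y~z : AgreeOff j y z
      y~z = near y≈z j yⱼ≢zⱼ

  square : AgreeOff j u v → Neighbours u z → Between v w z → w ≢ u → w ≢ v → AgreeOff j z w
  square {j = j} {u = u} {v} {z} {w} u~v u≈z v-w-z w≢u w≢v = agreeOff agreeAt
    where
    agreeAt : ∀ t → t ≢ j → lookup z t ≡ lookup w t
    agreeAt t t≢j with between v-w-z t | lookup u t ≟ᴬ lookup z t
    ... | inj₂ wₜ≡zₜ | _ = sym wₜ≡zₜ
    ... | inj₁ vₜ≡wₜ | yes uₜ≡zₜ = trans (sym uₜ≡zₜ) (trans (agree u~v t t≢j) vₜ≡wₜ)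
    ... | inj₁ vₜ≡wₜ | no uₜ≢zₜ = ⊥-elim (w-endpoint (between v-w-z j))
      where
      -- Now u and z differ only at t ≠ j, so w, which takes each coordinate
      -- from v or z, lies on the j-line through u and v.
      u~z : AgreeOff t u z
      u~z = near u≈z t uₜ≢zₜ
      w~u : AgreeOff j w u
      w~u = agreeOff wu
        where
        wu : ∀ s → s ≢ j → lookup w s ≡ lookup u s
        wu s s≢j with s ≟ t | between v-w-z s
        ... | yes refl | _ = trans (sym vₜ≡wₜ) (sym (agree u~v t t≢j))
        ... | no _ | inj₁ vₛ≡wₛ = trans (sym vₛ≡wₛ) (sym (agree u~v s s≢j))
        ... | no s≢t | inj₂ wₛ≡zₛ = trans wₛ≡zₛ (sym (agree u~z s s≢t))
      w-endpoint : lookup v j ≡ lookup w j ⊎ lookup w j ≡ lookup z j → ⊥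
      w-endpoint (inj₁ vⱼ≡wⱼ) = w≢v (agreeOff⇒≡ (agreeOff-trans w~u u~v) (sym vⱼ≡wⱼ))
      w-endpoint (inj₂ wⱼ≡zⱼ) =
        w≢u (agreeOff⇒≡ w~u (trans wⱼ≡zⱼ (sym (agree u~z j (t≢j ∘ sym)))))

  connected : ∀ {ℓ} {x y : Vec A n} (Q : Vec A n → Set ℓ) →
              (∀ {k x y} → AgreeOff k x y → Q x → Q y) → Q x → Q y
  connected {x = []} {[]} Q step q = q
  connected {x = b ∷ x} {c ∷ y} Q step q =
    connected (λ v → Q (c ∷ v)) (step ∘ agreeOff-∷) (step (agreeOff-head b c x) q)

  connected-fixing : ∀ {ℓ} {x y : Vec A n} (Q : Vec A n → Set ℓ) i →
                     (∀ {k x y} → k ≢ i → AgreeOff k x y → Q x → Q y) →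
                     lookup x i ≡ lookup y i → Q x → Q y
  connected-fixing {x = b ∷ x} {.b ∷ y} Q zero step refl q =
    connected (λ v → Q (b ∷ v)) (step (λ ()) ∘ agreeOff-∷) q
  connected-fixing {x = b ∷ x} {c ∷ y} Q (suc i) step xᵢ≡yᵢ q =
    connected-fixing (λ v → Q (c ∷ v)) i (λ k≢i → step (k≢i ∘ suc-injective) ∘ agreeOff-∷)
                     xᵢ≡yᵢ (step (λ ()) (agreeOff-head b c x) q)

module FinHamming {m : ℕ} = Hamming (_≟_ {m})
open FinHamming

δ : ∀ {m} → Fin m → Fin m → ℕ
δ a b = wEq (a ∷ b ∷ [])

δ-refl : ∀ {m} (a : Fin m) → δ a a ≡ 1
δ-refl a with a ≟ a
... | yes _ = refl
... | no a≢a = contradiction refl a≢a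

δ-≢ : ∀ {m} {a b : Fin m} → a ≢ b → δ a b ≡ 0
δ-≢ {a = a} {b} a≢b with a ≟ b
... | yes a≡b = contradiction a≡b a≢b
... | no _ = refl

δ-between : ∀ {m} {a b c : Fin m} → a ≡ b ⊎ b ≡ c → δ a b + δ b c ≡ 1 + δ a c
δ-between {a = a} {c = c} (inj₁ refl) = cong (_+ δ a c) (δ-refl a)
δ-between {a = a} {b} (inj₂ refl) = trans (cong (δ a b +_) (δ-refl b)) (+-comm (δ a b) 1)

δ-not-between : ∀ {m} {a b c : Fin m} → ¬ (a ≡ b ⊎ b ≡ c) → δ a b + δ b c ≡ 0
δ-not-between ¬abc = cong₂ _+_ (δ-≢ (¬abc ∘ inj₁)) (δ-≢ (¬abc ∘ inj₂))

δ-triangle : ∀ {m} (a b c : Fin m) → δ a b + δ b c ≤ 1 + δ a c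
δ-triangle a b c with R? (a ∷ b ∷ c ∷ [])
... | yes abc = ≤-reflexive (δ-between abc)
... | no ¬abc = ≤-trans (≤-reflexive (δ-not-between ¬abc)) z≤n

δ-between⁻¹ : ∀ {m} {a b c : Fin m} → δ a b + δ b c ≡ 1 + δ a c → a ≡ b ⊎ b ≡ c
δ-between⁻¹ {a = a} {b} {c} eq with R? (a ∷ b ∷ c ∷ [])
... | yes abc = abc
... | no ¬abc with trans (sym (δ-not-between ¬abc)) eq
...   | ()

+-≤-≡⇒≡ : ∀ {p q r s} → p ≤ r → q ≤ s → p + q ≡ r + s → p ≡ r × q ≡ s
+-≤-≡⇒≡ {p} {q} {r} {s} p≤r q≤s eq =
  p≡r , +-cancelˡ-≡ r q s (trans (cong (_+ q) (sym p≡r)) eq)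
  where
  r≤p : r ≤ p
  r≤p = +-cancelʳ-≤ q r p (≤-trans (+-monoʳ-≤ r q≤s) (≤-reflexive (sym eq)))
  p≡r : p ≡ r
  p≡r = ≤-antisym p≤r r≤p

agreements : ∀ {m n} → Vec (Fin m) n → Vec (Fin m) n → ℕ
agreements x y = prod +-monoid (map wEq (transpose (x ∷ y ∷ [])))

+-agreements-∷ : ∀ {m n} (a b c : Fin m) (x y z : Vec (Fin m) n) →
                 agreements (a ∷ x) (b ∷ y) + agreements (b ∷ y) (c ∷ z) ≡
                 (δ a b + δ b c) + (agreements x y + agreements y z)
+-agreements-∷ a b c x y z = interchange (δ a b) (agreements x y) (δ b c) (agreements y z)

suc-+-agreements-∷ : ∀ {m} n (a c : Fin m) (x z : Vec (Fin m) n) →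
                     suc n + agreements (a ∷ x) (c ∷ z) ≡ (1 + δ a c) + (n + agreements x z)
suc-+-agreements-∷ n a c x z = interchange 1 n (δ a c) (agreements x z)

agreements-triangle : ∀ {m n} (x y z : Vec (Fin m) n) →
                      agreements x y + agreements y z ≤ n + agreements x z
agreements-triangle [] [] [] = z≤n
agreements-triangle {n = suc n} (a ∷ x) (b ∷ y) (c ∷ z) = begin
  agreements (a ∷ x) (b ∷ y) + agreements (b ∷ y) (c ∷ z) ≡⟨ +-agreements-∷ a b c x y z ⟩
  (δ a b + δ b c) + (agreements x y + agreements y z)     ≤⟨ +-mono-≤ (δ-triangle a b c)
                                                                       (agreements-triangle x y z) ⟩
  (1 + δ a c) + (n + agreements x z)                      ≡⟨ suc-+-agreements-∷ n a c x z ⟨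
  suc n + agreements (a ∷ x) (c ∷ z)                      ∎
  where open ≤-Reasoning

between⇒agreements : ∀ {m n} {x y z : Vec (Fin m) n} → Between x y z →
                     agreements x y + agreements y z ≡ n + agreements x z
between⇒agreements {x = []} {[]} {[]} _ = refl
between⇒agreements {n = suc n} {a ∷ x} {b ∷ y} {c ∷ z} x-y-z = begin
  agreements (a ∷ x) (b ∷ y) + agreements (b ∷ y) (c ∷ z) ≡⟨ +-agreements-∷ a b c x y z ⟩
  (δ a b + δ b c) + (agreements x y + agreements y z)     ≡⟨ cong₂ _+_ (δ-between (between x-y-z zero))
                                                                       (between⇒agreements x-y-z′) ⟩
  (1 + δ a c) + (n + agreements x z)                      ≡⟨ suc-+-agreements-∷ n a c x z ⟨
  suc n + agreements (a ∷ x) (c ∷ z)                      ∎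
  where
  open ≡-Reasoning
  x-y-z′ : Between x y z
  x-y-z′ = coordinatewise (between x-y-z ∘ suc)

agreements⇒between : ∀ {m n} {x y z : Vec (Fin m) n} →
                     agreements x y + agreements y z ≡ n + agreements x z → Between x y z
agreements⇒between {x = []} {[]} {[]} _ = coordinatewise λ ()
agreements⇒between {n = suc n} {a ∷ x} {b ∷ y} {c ∷ z} eq = coordinatewise λ where
    zero → δ-between⁻¹ (proj₁ split)
    (suc t) → between (agreements⇒between (proj₂ split)) t
  where
  split : δ a b + δ b c ≡ 1 + δ a c × agreements x y + agreements y z ≡ n + agreements x z
  split = +-≤-≡⇒≡ (δ-triangle a b c) (agreements-triangle x y z)
            (trans (sym (+-agreements-∷ a b c x y z)) (trans eq (suc-+-agreements-∷ n a c x z)))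

betweenᵇ : ∀ {m n} → Vec (Fin m) n → Vec (Fin m) n → Vec (Fin m) n → Bool
betweenᵇ x y z = prod ∧-monoid (map wR (transpose (x ∷ y ∷ z ∷ [])))

T-wR : ∀ {m} (v : Vec (Fin m) 3) → T (wR v) ⇔ R v
T-wR v with R? v
... | yes r = mk⇔ (λ _ → r) _
... | no ¬r = mk⇔ (λ ()) ¬r

T-betweenᵇ : ∀ {m n} (x y z : Vec (Fin m) n) → T (betweenᵇ x y z) ⇔ Between x y z
T-betweenᵇ [] [] [] = mk⇔ (λ _ → coordinatewise λ ()) _
T-betweenᵇ (a ∷ x) (b ∷ y) (c ∷ z) = mk⇔ to from
  where
  to : T (betweenᵇ (a ∷ x) (b ∷ y) (c ∷ z)) → Between (a ∷ x) (b ∷ y) (c ∷ z)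
  to holds = coordinatewise λ where
    zero → Equivalence.to (T-wR _) (proj₁ (Equivalence.to T-∧ holds))
    (suc t) → between (Equivalence.to (T-betweenᵇ x y z) (proj₂ (Equivalence.to T-∧ holds))) t
  from : Between (a ∷ x) (b ∷ y) (c ∷ z) → T (betweenᵇ (a ∷ x) (b ∷ y) (c ∷ z))
  from x-y-z = Equivalence.from T-∧
    ( Equivalence.from (T-wR _) (between x-y-z zero)
    , Equivalence.from (T-betweenᵇ x y z) (coordinatewise (between x-y-z ∘ suc)))

IsBetweennessAutomorphism : ∀ {m n} → B m n → Set
IsBetweennessAutomorphism f =
  ∀ {x y z} → Between x y z ⇔ Between (Inverse.to f x) (Inverse.to f y) (Inverse.to f z)

respects-wR⇒isBetweennessAutomorphism : ∀ {m n} (f : B m n) → Respects ∧-monoid wR f →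
                                        IsBetweennessAutomorphism f
respects-wR⇒isBetweennessAutomorphism f respects {x} {y} {z} =
  mk⇔ (transfer (respects (x ∷ y ∷ z ∷ []))) (transfer (sym (respects (x ∷ y ∷ z ∷ []))))
  where
  transfer : ∀ {x y z x′ y′ z′} → betweenᵇ x y z ≡ betweenᵇ x′ y′ z′ →
             Between x y z → Between x′ y′ z′
  transfer {x} {y} {z} {x′} {y′} {z′} eq =
    Equivalence.to (T-betweenᵇ x′ y′ z′) ∘ subst T eq ∘ Equivalence.from (T-betweenᵇ x y z)

respects-wEq⇒isBetweennessAutomorphism : ∀ {m n} (f : B m n) → Respects +-monoid wEq f →
                                         IsBetweennessAutomorphism f
respects-wEq⇒isBetweennessAutomorphism {n = n} f respects {x} {y} {z} = mk⇔
  (transfer (isometry x y) (isometry y z) (isometry x z))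
  (transfer (sym (isometry x y)) (sym (isometry y z)) (sym (isometry x z)))
  where
  isometry : ∀ x y → agreements x y ≡ agreements (Inverse.to f x) (Inverse.to f y)
  isometry x y = respects (x ∷ y ∷ [])
  transfer : ∀ {x y z x′ y′ z′ : Vec _ n} →
             agreements x y ≡ agreements x′ y′ → agreements y z ≡ agreements y′ z′ →
             agreements x z ≡ agreements x′ z′ → Between x y z → Between x′ y′ z′
  transfer xy yz xz x-y-z = agreements⇒between
    (trans (sym (cong₂ _+_ xy yz)) (trans (between⇒agreements x-y-z) (cong (n +_) xz)))

column : ∀ {a} {A : Set a} {k n} → Vec (Vec A n) k → Fin n → Vec A k
column rows t = map (λ r → lookup r t) rows

lookup-transpose : ∀ {a} {A : Set a} {k n} (rows : Vec (Vec A n) k) t →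
                   lookup (transpose rows) t ≡ column rows t
lookup-transpose [] t = lookup-replicate t []
lookup-transpose {n = n} (r ∷ rows) t = begin
  lookup (replicate n _∷_ ⊛ r ⊛ transpose rows) t
    ≡⟨ lookup-⊛ t (replicate n _∷_ ⊛ r) (transpose rows) ⟩
  lookup (replicate n _∷_ ⊛ r) t (lookup (transpose rows) t)
    ≡⟨ cong (_$ lookup (transpose rows) t) (lookup-⊛ t (replicate n _∷_) r) ⟩
  lookup (replicate n _∷_) t (lookup r t) (lookup (transpose rows) t)
    ≡⟨ cong (λ cons → cons (lookup r t) (lookup (transpose rows) t)) (lookup-replicate t _∷_) ⟩
  lookup r t ∷ lookup (transpose rows) t
    ≡⟨ cong (lookup r t ∷_) (lookup-transpose rows t) ⟩
  lookup r t ∷ column rows t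
    ∎
  where open ≡-Reasoning

lookup-map-transpose : ∀ {a c} {A : Set a} {C : Set c} {k n} (w : Vec A k → C)
                       (rows : Vec (Vec A n) k) t →
                       lookup (map w (transpose rows)) t ≡ w (column rows t)
lookup-map-transpose w rows t = trans (lookup-map t w (transpose rows)) (cong w (lookup-transpose rows t))

lookup-degMap : ∀ {m n} (α : Permutation′ n) (β : Vec (Permutation′ m) n) x j →
                lookup (degMap α β x) j ≡ lookup β (α ⟨$⟩ˡ j) ⟨$⟩ʳ lookup x (α ⟨$⟩ˡ j)
lookup-degMap α β x = lookup∘tabulate _

column-degMap : ∀ {m n k} (α : Permutation′ n) (β : Vec (Permutation′ m) n)
                (rows : Vec (Vec (Fin m) n) k) j →
                column (map (degMap α β) rows) j ≡
                map (lookup β (α ⟨$⟩ˡ j) ⟨$⟩ʳ_) (column rows (α ⟨$⟩ˡ j))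
column-degMap α β rows j = begin
  map (λ r → lookup r j) (map (degMap α β) rows) ≡⟨ map-∘ _ _ rows ⟨
  map (λ r → lookup (degMap α β r) j) rows       ≡⟨ map-cong (λ r → lookup-degMap α β r j) rows ⟩
  map (λ r → βᵢ ⟨$⟩ʳ lookup r i) rows            ≡⟨ map-∘ _ _ rows ⟩
  map (βᵢ ⟨$⟩ʳ_) (column rows i)                 ∎
  where
  open ≡-Reasoning
  i : Fin _
  i = α ⟨$⟩ˡ j
  βᵢ : Permutation′ _
  βᵢ = lookup β i

weight-degMap : ∀ {c m n k} {C : Set c} (w : Vec (Fin m) k → C) →
                (∀ (π : Permutation′ m) v → w (map (π ⟨$⟩ʳ_) v) ≡ w v) →
                ∀ (α : Permutation′ n) (β : Vec (Permutation′ m) n) rows j →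
                lookup (map w (transpose (map (degMap α β) rows))) j ≡
                lookup (map w (transpose rows)) (α ⟨$⟩ˡ j)
weight-degMap w w-invariant α β rows j = begin
  lookup (map w (transpose (map (degMap α β) rows))) j ≡⟨ lookup-map-transpose w _ j ⟩
  w (column (map (degMap α β) rows) j)                 ≡⟨ cong w (column-degMap α β rows j) ⟩
  w (map (lookup β i ⟨$⟩ʳ_) (column rows i))          ≡⟨ w-invariant (lookup β i) _ ⟩
  w (column rows i)                                    ≡⟨ lookup-map-transpose w rows i ⟨
  lookup (map w (transpose rows)) i                    ∎
  where
  open ≡-Reasoning
  i : Fin _
  i = α ⟨$⟩ˡ j

module _ {c ℓ} (M : CommutativeMonoid c ℓ) where
  open CommutativeMonoid M using (Carrier; _∙_; setoid)
  open MonoidSum M using (sum; sum-permute; sum-cong-≗)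

  prod≡sum : ∀ {k} (v : Vec Carrier k) → prod M v ≡ sum (lookup v)
  prod≡sum [] = refl
  prod≡sum (a ∷ v) = cong (a ∙_) (prod≡sum v)

  inDeg⇒respects : ∀ {m k n} (w : Vec (Fin m) k → Carrier) →
                   (∀ (π : Permutation′ m) v → w (map (π ⟨$⟩ʳ_) v) ≡ w v) →
                   (f : B m n) → InDeg f → Respects M w f
  inDeg⇒respects w w-invariant f (α , β , f≗deg) rows = begin
    prod M (weights rows)
      ≡⟨ prod≡sum (weights rows) ⟩
    sum (lookup (weights rows))
      ≈⟨ sum-permute (lookup (weights rows)) (Perm.flip α) ⟩
    sum (lookup (weights rows) ∘ (α ⟨$⟩ˡ_))
      ≡⟨ sum-cong-≗ (sym ∘ weight-degMap w w-invariant α β rows) ⟩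
    sum (lookup (weights (map (degMap α β) rows)))
      ≡⟨ cong (sum ∘ lookup ∘ weights) (map-cong f≗deg rows) ⟨
    sum (lookup (weights (map (Inverse.to f) rows)))
      ≡⟨ prod≡sum (weights (map (Inverse.to f) rows)) ⟨
    prod M (weights (map (Inverse.to f) rows))
      ∎
    where
    open import Relation.Binary.Reasoning.Setoid setoid
    weights : ∀ {n} → Vec (Vec (Fin _) n) _ → Vec Carrier n
    weights rows = map w (transpose rows)

wR-invariant : ∀ {m} (π : Permutation′ m) v → wR (map (π ⟨$⟩ʳ_) v) ≡ wR v
wR-invariant π (a ∷ b ∷ c ∷ []) =
  does-⇔ (mk⇔ (Sum.map π-injective π-injective) (Sum.map (cong (π ⟨$⟩ʳ_)) (cong (π ⟨$⟩ʳ_))))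
         (R? _) (R? _)
  where
  π-injective : Injective _≡_ _≡_ (π ⟨$⟩ʳ_)
  π-injective = Injection.injective (↔⇒↣ π)

wEq-invariant : ∀ {m} (π : Permutation′ m) v → wEq (map (π ⟨$⟩ʳ_) v) ≡ wEq v
wEq-invariant π (a ∷ b ∷ []) with a ≟ b
... | yes refl = δ-refl (π ⟨$⟩ʳ a)
... | no a≢b = δ-≢ (a≢b ∘ Injection.injective (↔⇒↣ π))

module BetweennessAutomorphism {m n} (f : B m n) (automorphism : IsBetweennessAutomorphism f)
                               {a₀ a₁ : Fin m} (a₀≢a₁ : a₀ ≢ a₁) where

  open Inverse f using (to; from; strictlyInverseˡ)
  open ≡-Reasoning

  to-injective : Injective _≡_ _≡_ to
  to-injective = Injection.injective (↔⇒↣ f)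

  preserves : ∀ {x y z} → Between x y z → Between (to x) (to y) (to z)
  preserves = Equivalence.to automorphism

  reflects : ∀ {x y z} → Between (to x) (to y) (to z) → Between x y z
  reflects = Equivalence.from automorphism

  to-neighbours : ∀ {i x y} → AgreeOff i x y → Neighbours (to x) (to y)
  to-neighbours {x = x} {y} x~y = endpoints⇒neighbours image-endpoints
    where
    image-endpoints : ∀ {u} → Between (to x) u (to y) → u ≡ to x ⊎ u ≡ to y
    image-endpoints {u} x-u-y = Sum.map image image (line-endpoints x~y (reflects x-u-y′))
      where
      x-u-y′ : Between (to x) (to (from u)) (to y)
      x-u-y′ = subst (λ v → Between (to x) v (to y)) (sym (strictlyInverseˡ u)) x-u-y
      image : ∀ {v} → from u ≡ v → u ≡ to v
      image refl = sym (strictlyInverseˡ u)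

  o : Vec (Fin m) n
  o = replicate n a₀

  e : Fin n → Vec (Fin m) n
  e i = o [ i ]≔ a₁

  o~e : ∀ i → AgreeOff i o (e i)
  o~e i = agreeOff-update o i a₁

  o≢e : ∀ i → o ≢ e i
  o≢e i o≡eᵢ = a₀≢a₁ (begin
    a₀             ≡⟨ lookup-replicate i a₀ ⟨
    lookup o i     ≡⟨ cong (flip lookup i) o≡eᵢ ⟩
    lookup (e i) i ≡⟨ lookup∘update i o a₁ ⟩
    a₁             ∎)

  e-o-e : ∀ {i k} → i ≢ k → Between (e i) o (e k)
  e-o-e {i} i≢k = agreeOff⇒between (agreeOff-sym (o~e i)) (sym (lookup∘update′ i≢k o a₁))

  α-separates : ∀ i → ∃ λ j → lookup (to o) j ≢ lookup (to (e i)) j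
  α-separates i = ≢⇒lookup-≢ (o≢e i ∘ to-injective)

  α : Fin n → Fin n
  α = proj₁ ∘ α-separates

  to-o≢to-e : ∀ i → lookup (to o) (α i) ≢ lookup (to (e i)) (α i)
  to-o≢to-e = proj₂ ∘ α-separates

  MapsLine : Fin n → Fin n → Vec (Fin m) n → Set
  MapsLine i j x = ∀ y → AgreeOff i x y → AgreeOff j (to x) (to y)

  mapsLine-o : ∀ i → MapsLine i (α i) o
  mapsLine-o i y o~y = triangle-in-line
    (near (to-neighbours (o~e i)) (α i) (to-o≢to-e i))
    (o≢e i ∘ to-injective)
    (to-neighbours o~y)
    (to-neighbours (agreeOff-trans (agreeOff-sym (o~e i)) o~y))

  mapsLine-step : ∀ {i j k x z} → AgreeOff k x z → MapsLine i j x → MapsLine i j z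
  mapsLine-step {i} {j} {k} {x} {z} x~z maps y z~y with k ≟ i | lookup x k ≟ lookup z k
  ... | yes refl | _ = agreeOff-trans (agreeOff-sym (maps z x~z)) (maps y (agreeOff-trans x~z z~y))
  ... | no _ | yes xₖ≡zₖ = subst (MapsLine i j) (agreeOff⇒≡ x~z xₖ≡zₖ) maps y z~y
  ... | no k≢i | no xₖ≢zₖ =
    square (maps y′ (agreeOff-update x i (lookup y i))) (to-neighbours x~z) (preserves y′-y-z)
           (y≢x ∘ to-injective) (y≢y′ ∘ to-injective)
    where
    -- x, y′, y, z is a square with sides in directions i, k, i, k.
    y′ : Vec (Fin m) n
    y′ = x [ i ]≔ lookup y i
    yₖ≡zₖ : lookup y k ≡ lookup z k
    yₖ≡zₖ = sym (agree z~y k k≢i)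
    y′~y : AgreeOff k y′ y
    y′~y = agreeOff agreeAt
      where
      agreeAt : ∀ t → t ≢ k → lookup y′ t ≡ lookup y t
      agreeAt t t≢k with t ≟ i
      ... | yes refl = lookup∘update i x (lookup y i)
      ... | no t≢i = trans (lookup∘update′ t≢i x _) (trans (agree x~z t t≢k) (agree z~y t t≢i))
    y′-y-z : Between y′ y z
    y′-y-z = agreeOff⇒between y′~y yₖ≡zₖ
    y≢x : y ≢ x
    y≢x y≡x = xₖ≢zₖ (trans (cong (flip lookup k) (sym y≡x)) yₖ≡zₖ)
    y≢y′ : y ≢ y′
    y≢y′ y≡y′ =
      xₖ≢zₖ (trans (sym (lookup∘update′ k≢i x _)) (trans (cong (flip lookup k) (sym y≡y′)) yₖ≡zₖ))

  mapsLine : ∀ i x → MapsLine i (α i) x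
  mapsLine i x = connected (MapsLine i (α i)) mapsLine-step (mapsLine-o i)

  α-injective : Injective _≡_ _≡_ α
  α-injective {i} {k} αᵢ≡αₖ with i ≟ k
  ... | yes i≡k = i≡k
  ... | no i≢k with between (preserves (e-o-e i≢k)) (α i)
  ...   | inj₁ eq = contradiction (sym eq) (to-o≢to-e i)
  ...   | inj₂ eq rewrite αᵢ≡αₖ = contradiction eq (to-o≢to-e k)

  β : Fin n → Fin m → Fin m
  β i b = lookup (to (o [ i ]≔ b)) (α i)

  β-injective : ∀ i → Injective _≡_ _≡_ (β i)
  β-injective i {b} {c} βb≡βc = begin
    b                     ≡⟨ lookup∘update i o b ⟨
    lookup (o [ i ]≔ b) i ≡⟨ cong (flip lookup i) ob≡oc ⟩
    lookup (o [ i ]≔ c) i ≡⟨ lookup∘update i o c ⟩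
    c                     ∎
    where
    ob~oc : AgreeOff i (o [ i ]≔ b) (o [ i ]≔ c)
    ob~oc = agreeOff-trans (agreeOff-sym (agreeOff-update o i b)) (agreeOff-update o i c)
    ob≡oc : o [ i ]≔ b ≡ o [ i ]≔ c
    ob≡oc = to-injective (agreeOff⇒≡ (mapsLine i _ _ ob~oc) βb≡βc)

  lookup-to-α : ∀ x i → lookup (to x) (α i) ≡ β i (lookup x i)
  lookup-to-α x i = connected-fixing (λ z → lookup (to z) (α i) ≡ β i (lookup x i)) i step
                                     (lookup∘update i o (lookup x i)) refl
    where
    step : ∀ {k y z} → k ≢ i → AgreeOff k y z →
           lookup (to y) (α i) ≡ β i (lookup x i) → lookup (to z) (α i) ≡ β i (lookup x i)
    step {k} k≢i y~z = trans (sym (agree (mapsLine k _ _ y~z) (α i) (k≢i ∘ α-injective ∘ sym)))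

  αₚ : Permutation′ n
  αₚ = permutationOf α α-injective

  βₚ : Vec (Permutation′ m) n
  βₚ = tabulate λ i → permutationOf (β i) (β-injective i)

  inDeg : InDeg f
  inDeg = αₚ , βₚ , λ x → Pointwise-≡⇒≡ (ext (to≗deg x))
    where
    to≗deg : ∀ x t → lookup (to x) t ≡ lookup (degMap αₚ βₚ x) t
    to≗deg x t = begin
      lookup (to x) t             ≡⟨ cong (lookup (to x)) (Perm.inverseʳ αₚ) ⟨
      lookup (to x) (α i)         ≡⟨ lookup-to-α x i ⟩
      β i (lookup x i)            ≡⟨ cong (_⟨$⟩ʳ lookup x i) (lookup∘tabulate _ i) ⟨
      lookup βₚ i ⟨$⟩ʳ lookup x i ≡⟨ lookup-degMap αₚ βₚ x t ⟨
      lookup (degMap αₚ βₚ x) t   ∎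
      where
      i : Fin n
      i = αₚ ⟨$⟩ˡ t

Vec-irrelevant : ∀ {a} {A : Set a} {n} → Irrelevant A → Irrelevant (Vec A n)
Vec-irrelevant irrelevant [] [] = refl
Vec-irrelevant irrelevant (a ∷ x) (b ∷ y) =
  cong₂ _∷_ (irrelevant a b) (Vec-irrelevant irrelevant x y)

subsingleton⇒inDeg : ∀ {m n} (f : B m n) → Irrelevant (Fin m) → InDeg f
subsingleton⇒inDeg {n = n} f irrelevant =
  Perm.id , replicate n Perm.id , λ x → Vec-irrelevant irrelevant _ _

isBetweennessAutomorphism⇒inDeg : ∀ {m n} (f : B m n) → IsBetweennessAutomorphism f → InDeg f
isBetweennessAutomorphism⇒inDeg {zero} f _ = subsingleton⇒inDeg f λ ()
isBetweennessAutomorphism⇒inDeg {suc zero} f _ = subsingleton⇒inDeg f λ { zero zero → refl }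
isBetweennessAutomorphism⇒inDeg {suc (suc _)} f automorphism =
  BetweennessAutomorphism.inDeg f automorphism {zero} {suc zero} λ ()

lemma11 : ∀ (m n : ℕ) (f : B m n) →
              (InDeg f ⇔ InPol ∧-monoid wR f) × (InPol ∧-monoid wR f ⇔ InPol +-monoid wEq f)
lemma11 m n f = mk⇔ deg⇒wR wR⇒deg , mk⇔ (deg⇒wEq ∘ wR⇒deg) (deg⇒wR ∘ wEq⇒deg)
  where
  deg⇒wR : InDeg f → InPol ∧-monoid wR f
  deg⇒wR = inDeg⇒respects ∧-monoid wR wR-invariant f
  deg⇒wEq : InDeg f → InPol +-monoid wEq f
  deg⇒wEq = inDeg⇒respects +-monoid wEq wEq-invariant f
  wR⇒deg : InPol ∧-monoid wR f → InDeg f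
  wR⇒deg = isBetweennessAutomorphism⇒inDeg f ∘ respects-wR⇒isBetweennessAutomorphism f
  wEq⇒deg : InPol +-monoid wEq f → InDeg f
  wEq⇒deg = isBetweennessAutomorphism⇒inDeg f ∘ respects-wEq⇒isBetweennessAutomorphism f
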